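{- Let $k,p,q,r$ be positive integers. Let $\mathcal S$ and $\mathcal T$ be balanced rooted binary phylogenetic trees on $p\cdot 2^k$ and $q\cdot 2^k$ leaves, respectively, where $\mathcal S$ consists of $p$ pendant subtrees $\mathcal S_1,\ldots,\mathcal S_p$ each of size $2^k$ and $\mathcal T$ consists of $q$ pendant subtrees $\mathcal T_1,\ldots,\mathcal T_q$ each of size $2^k$. Suppose that (i) for all $i,j$, $|\mathcal L(\mathcal S_i)\cap\mathcal L(\mathcal T_j)|=r$, and (ii) for all $i,j$, the restrictions $\mathcal S_i|(\mathcal L(\mathcal S_i)\cap\mathcal L(\mathcal T_j))$ and $\mathcal T_j|(\mathcal L(\mathcal S_i)\cap\mathcal L(\mathcal T_j))$ are a pair of anti-caterpillars. Then $\mathrm{mast}(\mathcal S,\mathcal T)\le 2\max\{p,q\}$.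
   Context: A rooted binary phylogenetic tree is a rooted tree with leaves labelled bijectively by a finite set (its label set $\mathcal L(\cdot)$), root of degree two and other interior vertices of degree three (or a single vertex if there is one leaf). It is balanced if it has $2^m$ leaves and height $m$ (height = number of edges on a longest root-to-leaf path). A pendant subtree is a subtree detachable by deleting a single edge; its size is its number of leaves. For $Y\subseteq\mathcal L(\mathcal T)$, the restriction $\mathcal T|Y$ is obtained from the minimal subtree of $\mathcal T$ connecting the leaves in $Y$ by suppressing non-root degree-two vertices. An $n$-caterpillar $(l_1,\ldots,l_n)$ is a tree on leaves $l_1,\ldots,l_n$ that is a single leaf if $n=1$, and otherwise has $l_1,l_2$ with a common parent and, for each $i\in\{2,\ldots,n-1\}$, the parent of $l_{i+1}$ is the parent of the parent of $l_i$. Caterpillars $(l_1,\ldots,l_n)$ and $(l'_1,\ldots,l'_n)$ on the same leaf set with $l_i=l'_{n-i+1}$ for all $i$ are a pair of anti-caterpillars. $\mathrm{mast}(\mathcal S,\mathcal T)$ is the maximum $|Y|$ over $Y\subseteq\mathcal L(\mathcal S)\cap\mathcal L(\mathcal T)$ with $\mathcal S|Y$ and $\mathcal T|Y$ isomorphic as leaf-labelled rooted trees. -}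

module Defs where

open import Data.Nat using (ℕ; zero; suc; _+_; _*_; _^_; _≤_; _⊔_)
open import Data.Nat.Properties using (_≟_)
open import Data.Fin using (Fin)
open import Data.Bool using (if_then_else_)
open import Data.Maybe using (Maybe; just; nothing)
open import Data.List using (List; []; _∷_; _++_; length; foldl; reverse; filter; concatMap; allFin)
open import Data.List.Membership.Propositional using (_∈_)
open import Data.List.Membership.DecPropositional _≟_ using (_∈?_)
open import Data.List.Relation.Unary.Unique.Propositional using (Unique)
open import Data.Product using (Σ; _×_)
open import Relation.Nullary using (does)
open import Relation.Binary.PropositionalEquality using (_≡_)

-- Rooted binary trees with leaves labelled by natural numbers.
-- (Child order is irrelevant; see _≅_ below.)
data Tree : Set where
  leaf : ℕ → Tree
  node : Tree → Tree → Tree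

leaves : Tree → List ℕ
leaves (leaf x)   = x ∷ []
leaves (node a b) = leaves a ++ leaves b

size : Tree → ℕ
size t = length (leaves t)

height : Tree → ℕ
height (leaf _)   = 0
height (node a b) = suc (height a ⊔ height b)

-- phylogenetic tree: labelling is bijective, i.e. labels are pairwise distinct
Phylo : Tree → Set
Phylo t = Unique (leaves t)

Balanced : Tree → Set
Balanced t = Σ ℕ (λ m → (size t ≡ 2 ^ m) × (height t ≡ m))

data Pendant : Tree → Tree → Set where
  here : ∀ {t} → Pendant t t
  inl  : ∀ {s a b} → Pendant s a → Pendant s (node a b)
  inr  : ∀ {s a b} → Pendant s b → Pendant s (node a b)

data _≅_ : Tree → Tree → Set where
  leaf≅ : ∀ {x} → leaf x ≅ leaf x
  node≅ : ∀ {a b c d} → a ≅ c → b ≅ d → node a b ≅ node c d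
  swap≅ : ∀ {a b c d} → a ≅ d → b ≅ c → node a b ≅ node c d

data _≅ᴹ_ : Maybe Tree → Maybe Tree → Set where
  nothing≅ : nothing ≅ᴹ nothing
  just≅    : ∀ {a b} → a ≅ b → just a ≅ᴹ just b

-- restriction T|Y: keep leaves in Y, delete empty parts, suppress
-- non-root degree-two vertices (nothing = empty restriction)
combine : Maybe Tree → Maybe Tree → Maybe Tree
combine nothing  r        = r
combine (just a) nothing  = just a
combine (just a) (just b) = just (node a b)

restrict : Tree → List ℕ → Maybe Tree
restrict (leaf x)   Y = if does (x ∈? Y) then just (leaf x) else nothing
restrict (node a b) Y = combine (restrict a Y) (restrict b Y)

common : Tree → Tree → List ℕ
common A B = filter (_∈? leaves B) (leaves A)

-- the n-caterpillar (l1,...,ln) for n ≥ 1 (given as l1 and [l2,...,ln])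
caterpillar : ℕ → List ℕ → Tree
caterpillar l₁ ls = foldl (λ t l → node t (leaf l)) (leaf l₁) ls

caterpillarL : List ℕ → Maybe Tree
caterpillarL []       = nothing
caterpillarL (l ∷ ls) = just (caterpillar l ls)

AntiCaterpillars : Maybe Tree → Maybe Tree → Set
AntiCaterpillars A B =
  Σ ℕ (λ l → Σ (List ℕ) (λ ls →
    (A ≅ᴹ caterpillarL (l ∷ ls)) × (B ≅ᴹ caterpillarL (reverse (l ∷ ls)))))

Agreement : Tree → Tree → List ℕ → Set
Agreement S T Y =
  Unique Y × (∀ {y} → y ∈ Y → (y ∈ leaves S) × (y ∈ leaves T)) ×
  (restrict S Y ≅ᴹ restrict T Y)

MastAtMost : Tree → Tree → ℕ → Set
MastAtMost S T n = ∀ Y → Agreement S T Y → length Y ≤ n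

familyLeaves : ∀ {n} → (Fin n → Tree) → List ℕ
familyLeaves {n} F = concatMap (λ i → leaves (F i)) (allFin n)

-- An agreement set Y meets every cell L(Sᵢ) ∩ L(Tⱼ) in at most two leaves: three of them, in the order
-- u, v, w along the caterpillar Sᵢ|cell, display the rooted triple uv|w in S, hence in T since S|Y ≅ T|Y,
-- while the reversed caterpillar Tⱼ|cell displays the incompatible triple wv|u in T.
-- Then induct on pendant subtrees U of S and V of T, of heights a + k and b + k, with U|Y ≅ V|Y, to show
-- |U|Y| ≤ 2 max(2^a, 2^b). If a = 0, U lies inside one block Sᵢ, so V|Y meets each of the 2^b blocks
-- below V in at most two leaves; b = 0 is symmetric; otherwise the root of U|Y ≅ V|Y either lies in a
-- single child of U or V, or matches the children of U and V pairwise. Take U = S, V = T, p = 2^a, q = 2^b.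
module Submission where

open import Defs
open import Data.Nat using (ℕ; zero; suc; _+_; _*_; _^_; _≤_; _<_; _⊔_; z≤n; s≤s)
open import Data.Nat.Properties
open import Algebra.Properties.CommutativeSemigroup *-commutativeSemigroup using (x∙yz≈y∙xz)
open import Data.Fin using (Fin)
open import Data.Bool using (true; false)
open import Data.Maybe using (Maybe; just; nothing)
open import Data.List using (List; []; _∷_; _++_; length; foldl; reverse; filter; allFin)
open import Data.List.Properties using (filter-++; length-++; length-++-sucʳ; ++-identityʳ; ++-assoc)
open import Data.List.Membership.Propositional using (_∈_)
open import Data.List.Membership.Propositional.Properties
  using (∈-filter⁺; ∈-filter⁻; ∈-++⁺ˡ; ∈-++⁺ʳ; ∈-++⁻; ∈-∃++; ∈-concatMap⁻; ∈-length)
open import Data.List.Membership.DecPropositional _≟_ using (_∈?_)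
open import Data.List.Relation.Unary.Any using (here; there; satisfied)
import Data.List.Relation.Unary.All as All
import Data.List.Relation.Unary.All.Properties as All
open import Data.List.Relation.Unary.AllPairs using ([]; _∷_)
open import Data.List.Relation.Unary.Unique.Propositional using (Unique)
import Data.List.Relation.Unary.Unique.Propositional.Properties as Unique
open import Data.List.Relation.Binary.Subset.Propositional using (_⊆_)
open import Data.List.Relation.Binary.Subset.Propositional.Properties using (filter⁺′)
open import Data.List.Relation.Binary.Sublist.Propositional
  using (_∷ʳ_; _∷_; minimum; lookup; ⊆-trans) renaming (_⊆_ to _⊑_)
open import Data.List.Relation.Binary.Sublist.Propositional.Properties using (reverse⁺; filter-⊆)
open import Data.List.Relation.Binary.Permutation.Propositional using (_↭_)
open import Data.List.Relation.Binary.Permutation.Propositional.Properties using (∈-resp-↭)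
open import Data.Product using (∃; _×_; _,_; proj₁; proj₂)
open import Data.Sum using (_⊎_; inj₁; inj₂)
open import Data.Empty using (⊥; ⊥-elim)
open import Relation.Nullary using (does)
open import Relation.Nullary.Decidable using (_×-dec_)
open import Relation.Unary using (Decidable)
open import Relation.Binary.PropositionalEquality

private variable A : Set

Unique-++⁻ˡ : ∀ (xs : List A) {ys} → Unique (xs ++ ys) → Unique xs
Unique-++⁻ˡ []       _          = []
Unique-++⁻ˡ (x ∷ xs) (x∉ ∷ xs!) = All.++⁻ˡ xs x∉ ∷ Unique-++⁻ˡ xs xs!

Unique-++⁻ʳ : ∀ (xs : List A) {ys} → Unique (xs ++ ys) → Unique ys
Unique-++⁻ʳ []       ys!       = ys!
Unique-++⁻ʳ (x ∷ xs) (_ ∷ xs!) = Unique-++⁻ʳ xs xs!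

Unique-++⇒disjoint : ∀ (xs : List A) {ys x} → Unique (xs ++ ys) → x ∈ xs → x ∈ ys → ⊥
Unique-++⇒disjoint (x ∷ xs) (x∉ ∷ _)  (here refl) x∈ys = All.lookup (All.++⁻ʳ xs x∉) x∈ys refl
Unique-++⇒disjoint (x ∷ xs) (_ ∷ xs!) (there x∈xs) x∈ys = Unique-++⇒disjoint xs xs! x∈xs x∈ys

Unique-⊆⇒length≤ : ∀ {xs ys : List A} → Unique xs → xs ⊆ ys → length xs ≤ length ys
Unique-⊆⇒length≤ {xs = []}     _          _     = z≤n
Unique-⊆⇒length≤ {xs = x ∷ xs} (x∉ ∷ xs!) x∷xs⊆ys with ∈-∃++ (x∷xs⊆ys (here refl))
... | ys₁ , ys₂ , refl =
  subst (suc (length xs) ≤_) (sym (length-++-sucʳ ys₁ x ys₂))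
    (s≤s (Unique-⊆⇒length≤ xs! (λ z∈xs → drop-x (x∷xs⊆ys (there z∈xs)) (All.lookup x∉ z∈xs))))
  where
  drop-x : ∀ {z} → z ∈ ys₁ ++ x ∷ ys₂ → x ≢ z → z ∈ ys₁ ++ ys₂
  drop-x z∈ x≢z with ∈-++⁻ ys₁ z∈
  ... | inj₁ z∈ys₁          = ∈-++⁺ˡ z∈ys₁
  ... | inj₂ (here refl)    = ⊥-elim (x≢z refl)
  ... | inj₂ (there z∈ys₂)  = ∈-++⁺ʳ ys₁ z∈ys₂

leavesᴹ : Maybe Tree → List ℕ
leavesᴹ nothing  = []
leavesᴹ (just t) = leaves t

sizeᴹ : Maybe Tree → ℕ
sizeᴹ m = length (leavesᴹ m)

leavesᴹ-combine : ∀ m₁ m₂ → leavesᴹ (combine m₁ m₂) ≡ leavesᴹ m₁ ++ leavesᴹ m₂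
leavesᴹ-combine nothing  _        = refl
leavesᴹ-combine (just a) nothing  = sym (++-identityʳ (leaves a))
leavesᴹ-combine (just _) (just _) = refl

leavesᴹ-restrict : ∀ t Y → leavesᴹ (restrict t Y) ≡ filter (_∈? Y) (leaves t)
leavesᴹ-restrict (leaf x) Y with does (x ∈? Y)
... | true  = refl
... | false = refl
leavesᴹ-restrict (node a b) Y = begin
  leavesᴹ (combine (restrict a Y) (restrict b Y))         ≡⟨ leavesᴹ-combine (restrict a Y) (restrict b Y) ⟩
  leavesᴹ (restrict a Y) ++ leavesᴹ (restrict b Y)        ≡⟨ cong₂ _++_ (leavesᴹ-restrict a Y) (leavesᴹ-restrict b Y) ⟩
  filter (_∈? Y) (leaves a) ++ filter (_∈? Y) (leaves b)  ≡⟨ filter-++ (_∈? Y) (leaves a) (leaves b) ⟨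
  filter (_∈? Y) (leaves a ++ leaves b)                   ∎
  where open ≡-Reasoning

∈-restrict⁺ : ∀ t {Y x} → x ∈ leaves t → x ∈ Y → x ∈ leavesᴹ (restrict t Y)
∈-restrict⁺ t {Y} x∈t x∈Y = subst (_ ∈_) (sym (leavesᴹ-restrict t Y)) (∈-filter⁺ (_∈? Y) x∈t x∈Y)

∈-restrict⁻ : ∀ t {Y x} → x ∈ leavesᴹ (restrict t Y) → x ∈ leaves t × x ∈ Y
∈-restrict⁻ t {Y} x∈t|Y = ∈-filter⁻ (_∈? Y) (subst (_ ∈_) (leavesᴹ-restrict t Y) x∈t|Y)

Unique-restrict : ∀ t Y → Unique (leaves t) → Unique (leavesᴹ (restrict t Y))
Unique-restrict t Y t! = subst Unique (sym (leavesᴹ-restrict t Y)) (Unique.filter⁺ (_∈? Y) t!)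

size-node : ∀ a b → size (node a b) ≡ size a + size b
size-node a b = length-++ (leaves a)

some-leaf : ∀ t → ∃ λ x → x ∈ leaves t
some-leaf (leaf x)   = x , here refl
some-leaf (node a _) = let x , x∈a = some-leaf a in x , ∈-++⁺ˡ x∈a

size>0 : ∀ t → 0 < size t
size>0 t = ∈-length (proj₂ (some-leaf t))

Pendant-trans : ∀ {s t u} → Pendant s t → Pendant t u → Pendant s u
Pendant-trans s⊑t here      = s⊑t
Pendant-trans s⊑t (inl t⊑u) = inl (Pendant-trans s⊑t t⊑u)
Pendant-trans s⊑t (inr t⊑u) = inr (Pendant-trans s⊑t t⊑u)

Pendant-childˡ : ∀ {a b t} → Pendant (node a b) t → Pendant a t
Pendant-childˡ = Pendant-trans (inl here)

Pendant-childʳ : ∀ {a b t} → Pendant (node a b) t → Pendant b t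
Pendant-childʳ = Pendant-trans (inr here)

Pendant-⊆ : ∀ {s t} → Pendant s t → leaves s ⊆ leaves t
Pendant-⊆ here         x∈s = x∈s
Pendant-⊆ (inl s⊑a)    x∈s = ∈-++⁺ˡ (Pendant-⊆ s⊑a x∈s)
Pendant-⊆ {t = node a _} (inr s⊑b) x∈s = ∈-++⁺ʳ (leaves a) (Pendant-⊆ s⊑b x∈s)

Pendant-Unique : ∀ {s t} → Pendant s t → Unique (leaves t) → Unique (leaves s)
Pendant-Unique here                      t! = t!
Pendant-Unique {t = node a _} (inl s⊑a) t! = Pendant-Unique s⊑a (Unique-++⁻ˡ (leaves a) t!)
Pendant-Unique {t = node a _} (inr s⊑b) t! = Pendant-Unique s⊑b (Unique-++⁻ʳ (leaves a) t!)

Pendant-size≤ : ∀ {s t} → Pendant s t → size s ≤ size t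
Pendant-size≤ here                       = ≤-refl
Pendant-size≤ (inl {a = a} {b} s⊑a) =
  ≤-trans (Pendant-size≤ s⊑a) (≤-trans (m≤m+n (size a) (size b)) (≤-reflexive (sym (size-node a b))))
Pendant-size≤ (inr {a = a} {b} s⊑b) =
  ≤-trans (Pendant-size≤ s⊑b) (≤-trans (m≤n+m (size b) (size a)) (≤-reflexive (sym (size-node a b))))

Pendant-size≡⇒≡ : ∀ {s t} → Pendant s t → size s ≡ size t → s ≡ t
Pendant-size≡⇒≡ here                  _ = refl
Pendant-size≡⇒≡ (inl {a = a} {b} s⊑a) e = ⊥-elim (<-irrefl (trans e (size-node a b))
  (≤-<-trans (Pendant-size≤ s⊑a) (m<m+n (size a) (size>0 b))))
Pendant-size≡⇒≡ (inr {a = a} {b} s⊑b) e = ⊥-elim (<-irrefl (trans e (size-node a b))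
  (≤-<-trans (Pendant-size≤ s⊑b) (m<n+m (size b) (size>0 a))))

Pendant-nested : ∀ {s₁ s₂ t x} → Unique (leaves t) → Pendant s₁ t → Pendant s₂ t →
                 x ∈ leaves s₁ → x ∈ leaves s₂ → Pendant s₁ s₂ ⊎ Pendant s₂ s₁
Pendant-nested _  here      s₂⊑t      _ _ = inj₂ s₂⊑t
Pendant-nested _  (inl s₁⊑a) here     _ _ = inj₁ (inl s₁⊑a)
Pendant-nested _  (inr s₁⊑b) here     _ _ = inj₁ (inr s₁⊑b)
Pendant-nested {t = node a _} t! (inl s₁⊑a) (inl s₂⊑a) x∈s₁ x∈s₂ =
  Pendant-nested (Unique-++⁻ˡ (leaves a) t!) s₁⊑a s₂⊑a x∈s₁ x∈s₂
Pendant-nested {t = node a _} t! (inr s₁⊑b) (inr s₂⊑b) x∈s₁ x∈s₂ =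
  Pendant-nested (Unique-++⁻ʳ (leaves a) t!) s₁⊑b s₂⊑b x∈s₁ x∈s₂
Pendant-nested {t = node a _} t! (inl s₁⊑a) (inr s₂⊑b) x∈s₁ x∈s₂ =
  ⊥-elim (Unique-++⇒disjoint (leaves a) t! (Pendant-⊆ s₁⊑a x∈s₁) (Pendant-⊆ s₂⊑b x∈s₂))
Pendant-nested {t = node a _} t! (inr s₁⊑b) (inl s₂⊑a) x∈s₁ x∈s₂ =
  ⊥-elim (Unique-++⇒disjoint (leaves a) t! (Pendant-⊆ s₂⊑a x∈s₂) (Pendant-⊆ s₁⊑b x∈s₁))

≅-⊆ : ∀ {s t} → s ≅ t → leaves s ⊆ leaves t
≅-⊆ leaf≅ x∈ = x∈
≅-⊆ (node≅ {a} {b} {c} a≅c b≅d) x∈ with ∈-++⁻ (leaves a) x∈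
... | inj₁ x∈a = ∈-++⁺ˡ (≅-⊆ a≅c x∈a)
... | inj₂ x∈b = ∈-++⁺ʳ (leaves c) (≅-⊆ b≅d x∈b)
≅-⊆ (swap≅ {a} {b} {c} a≅d b≅c) x∈ with ∈-++⁻ (leaves a) x∈
... | inj₁ x∈a = ∈-++⁺ʳ (leaves c) (≅-⊆ a≅d x∈a)
... | inj₂ x∈b = ∈-++⁺ˡ (≅-⊆ b≅c x∈b)

≅ᴹ-⊆ : ∀ {m n} → m ≅ᴹ n → leavesᴹ m ⊆ leavesᴹ n
≅ᴹ-⊆ nothing≅   ()
≅ᴹ-⊆ (just≅ s≅t) x∈ = ≅-⊆ s≅t x∈

≅-sym : ∀ {s t} → s ≅ t → t ≅ s
≅-sym leaf≅         = leaf≅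
≅-sym (node≅ p q) = node≅ (≅-sym p) (≅-sym q)
≅-sym (swap≅ p q) = swap≅ (≅-sym q) (≅-sym p)

≅ᴹ-sym : ∀ {m n} → m ≅ᴹ n → n ≅ᴹ m
≅ᴹ-sym nothing≅     = nothing≅
≅ᴹ-sym (just≅ s≅t) = just≅ (≅-sym s≅t)

≅-size : ∀ {s t} → s ≅ t → size s ≡ size t
≅-size leaf≅ = refl
≅-size (node≅ {a} {b} {c} {d} a≅c b≅d) = begin
  size (node a b)  ≡⟨ size-node a b ⟩
  size a + size b  ≡⟨ cong₂ _+_ (≅-size a≅c) (≅-size b≅d) ⟩
  size c + size d  ≡⟨ size-node c d ⟨
  size (node c d)  ∎
  where open ≡-Reasoning
≅-size (swap≅ {a} {b} {c} {d} a≅d b≅c) = begin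
  size (node a b)  ≡⟨ size-node a b ⟩
  size a + size b  ≡⟨ cong₂ _+_ (≅-size a≅d) (≅-size b≅c) ⟩
  size d + size c  ≡⟨ +-comm (size d) (size c) ⟩
  size c + size d  ≡⟨ size-node c d ⟨
  size (node c d)  ∎
  where open ≡-Reasoning

≅ᴹ-size : ∀ {m n} → m ≅ᴹ n → sizeᴹ m ≡ sizeᴹ n
≅ᴹ-size nothing≅     = refl
≅ᴹ-size (just≅ s≅t) = ≅-size s≅t

-- Triple t x y z: t displays the rooted triple xy|z.
data Triple : Tree → ℕ → ℕ → ℕ → Set where
  rootˡ : ∀ {a b x y z} → x ∈ leaves a → y ∈ leaves a → z ∈ leaves b → Triple (node a b) x y z
  rootʳ : ∀ {a b x y z} → x ∈ leaves b → y ∈ leaves b → z ∈ leaves a → Triple (node a b) x y z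
  subˡ  : ∀ {a b x y z} → Triple a x y z → Triple (node a b) x y z
  subʳ  : ∀ {a b x y z} → Triple b x y z → Triple (node a b) x y z

Tripleᴹ : Maybe Tree → ℕ → ℕ → ℕ → Set
Tripleᴹ nothing  _ _ _ = ⊥
Tripleᴹ (just t) x y z = Triple t x y z

Triple-leaves : ∀ {t x y z} → Triple t x y z → x ∈ leaves t × y ∈ leaves t × z ∈ leaves t
Triple-leaves {node a _} (rootˡ x∈ y∈ z∈) = ∈-++⁺ˡ x∈ , ∈-++⁺ˡ y∈ , ∈-++⁺ʳ (leaves a) z∈
Triple-leaves {node a _} (rootʳ x∈ y∈ z∈) = ∈-++⁺ʳ (leaves a) x∈ , ∈-++⁺ʳ (leaves a) y∈ , ∈-++⁺ˡ z∈
Triple-leaves {node a _} (subˡ s) with Triple-leaves s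
... | x∈ , y∈ , z∈ = ∈-++⁺ˡ x∈ , ∈-++⁺ˡ y∈ , ∈-++⁺ˡ z∈
Triple-leaves {node a _} (subʳ s) with Triple-leaves s
... | x∈ , y∈ , z∈ = ∈-++⁺ʳ (leaves a) x∈ , ∈-++⁺ʳ (leaves a) y∈ , ∈-++⁺ʳ (leaves a) z∈

Triple-swap : ∀ {t x y z} → Triple t x y z → Triple t y x z
Triple-swap (rootˡ x∈ y∈ z∈) = rootˡ y∈ x∈ z∈
Triple-swap (rootʳ x∈ y∈ z∈) = rootʳ y∈ x∈ z∈
Triple-swap (subˡ s)         = subˡ (Triple-swap s)
Triple-swap (subʳ s)         = subʳ (Triple-swap s)

Triple-≅ : ∀ {s t x y z} → s ≅ t → Triple s x y z → Triple t x y z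
Triple-≅ (node≅ a≅c b≅d) (rootˡ x∈ y∈ z∈) = rootˡ (≅-⊆ a≅c x∈) (≅-⊆ a≅c y∈) (≅-⊆ b≅d z∈)
Triple-≅ (node≅ a≅c b≅d) (rootʳ x∈ y∈ z∈) = rootʳ (≅-⊆ b≅d x∈) (≅-⊆ b≅d y∈) (≅-⊆ a≅c z∈)
Triple-≅ (node≅ a≅c _)   (subˡ s)          = subˡ (Triple-≅ a≅c s)
Triple-≅ (node≅ _ b≅d)   (subʳ s)          = subʳ (Triple-≅ b≅d s)
Triple-≅ (swap≅ a≅d b≅c) (rootˡ x∈ y∈ z∈) = rootʳ (≅-⊆ a≅d x∈) (≅-⊆ a≅d y∈) (≅-⊆ b≅c z∈)
Triple-≅ (swap≅ a≅d b≅c) (rootʳ x∈ y∈ z∈) = rootˡ (≅-⊆ b≅c x∈) (≅-⊆ b≅c y∈) (≅-⊆ a≅d z∈)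
Triple-≅ (swap≅ a≅d _)   (subˡ s)          = subʳ (Triple-≅ a≅d s)
Triple-≅ (swap≅ _ b≅c)   (subʳ s)          = subˡ (Triple-≅ b≅c s)

Tripleᴹ-≅ᴹ : ∀ {m n x y z} → m ≅ᴹ n → Tripleᴹ m x y z → Tripleᴹ n x y z
Tripleᴹ-≅ᴹ nothing≅     ()
Tripleᴹ-≅ᴹ (just≅ s≅t) s = Triple-≅ s≅t s

Triple-Pendant : ∀ {s t x y z} → Pendant s t → Triple s x y z → Triple t x y z
Triple-Pendant here      s = s
Triple-Pendant (inl s⊑a) s = subˡ (Triple-Pendant s⊑a s)
Triple-Pendant (inr s⊑b) s = subʳ (Triple-Pendant s⊑b s)

Triple-rotate-⊥ : ∀ {t x y z} → Unique (leaves t) → Triple t x y z → Triple t y z x → ⊥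
Triple-rotate-⊥ {node a b} t! = go
  where
  disjoint : ∀ {x} → x ∈ leaves a → x ∈ leaves b → ⊥
  disjoint = Unique-++⇒disjoint (leaves a) t!
  go : ∀ {x y z} → Triple (node a b) x y z → Triple (node a b) y z x → ⊥
  go (rootˡ x∈ y∈ z∈) (rootˡ _ _ x∈′)   = disjoint x∈ x∈′
  go (rootˡ x∈ y∈ z∈) (rootʳ y∈′ _ _)   = disjoint y∈ y∈′
  go (rootˡ x∈ y∈ z∈) (subˡ s)          = disjoint (proj₁ (proj₂ (Triple-leaves s))) z∈
  go (rootˡ x∈ y∈ z∈) (subʳ s)          = disjoint y∈ (proj₁ (Triple-leaves s))
  go (rootʳ x∈ y∈ z∈) (rootˡ y∈′ _ _)   = disjoint y∈′ y∈
  go (rootʳ x∈ y∈ z∈) (rootʳ _ _ x∈′)   = disjoint x∈′ x∈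
  go (rootʳ x∈ y∈ z∈) (subˡ s)          = disjoint (proj₁ (Triple-leaves s)) y∈
  go (rootʳ x∈ y∈ z∈) (subʳ s)          = disjoint z∈ (proj₁ (proj₂ (Triple-leaves s)))
  go (subˡ s) (rootˡ _ _ x∈′)           = disjoint (proj₁ (Triple-leaves s)) x∈′
  go (subˡ s) (rootʳ y∈′ _ _)           = disjoint (proj₁ (proj₂ (Triple-leaves s))) y∈′
  go (subˡ s) (subˡ s′)                 = Triple-rotate-⊥ (Unique-++⁻ˡ (leaves a) t!) s s′
  go (subˡ s) (subʳ s′)                 = disjoint (proj₁ (Triple-leaves s)) (proj₂ (proj₂ (Triple-leaves s′)))
  go (subʳ s) (rootˡ y∈′ _ _)           = disjoint y∈′ (proj₁ (proj₂ (Triple-leaves s)))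
  go (subʳ s) (rootʳ _ _ x∈′)           = disjoint x∈′ (proj₁ (Triple-leaves s))
  go (subʳ s) (subˡ s′)                 = disjoint (proj₂ (proj₂ (Triple-leaves s′))) (proj₁ (Triple-leaves s))
  go (subʳ s) (subʳ s′)                 = Triple-rotate-⊥ (Unique-++⁻ʳ (leaves a) t!) s s′

-- The triples displayed by combine m₁ m₂, read as a node with possibly empty children m₁ and m₂.
data ChildTriple (m₁ m₂ : Maybe Tree) (x y z : ℕ) : Set where
  rootˡ : x ∈ leavesᴹ m₁ → y ∈ leavesᴹ m₁ → z ∈ leavesᴹ m₂ → ChildTriple m₁ m₂ x y z
  rootʳ : x ∈ leavesᴹ m₂ → y ∈ leavesᴹ m₂ → z ∈ leavesᴹ m₁ → ChildTriple m₁ m₂ x y z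
  subˡ  : Tripleᴹ m₁ x y z → ChildTriple m₁ m₂ x y z
  subʳ  : Tripleᴹ m₂ x y z → ChildTriple m₁ m₂ x y z

Tripleᴹ-combine⁺ : ∀ m₁ m₂ {x y z} → ChildTriple m₁ m₂ x y z → Tripleᴹ (combine m₁ m₂) x y z
Tripleᴹ-combine⁺ (just _) (just _) (rootˡ x∈ y∈ z∈) = rootˡ x∈ y∈ z∈
Tripleᴹ-combine⁺ (just _) (just _) (rootʳ x∈ y∈ z∈) = rootʳ x∈ y∈ z∈
Tripleᴹ-combine⁺ (just _) nothing  (subˡ s)         = s
Tripleᴹ-combine⁺ (just _) (just _) (subˡ s)         = subˡ s
Tripleᴹ-combine⁺ nothing  _        (subʳ s)         = s
Tripleᴹ-combine⁺ (just _) (just _) (subʳ s)         = subʳ s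

Tripleᴹ-combine⁻ : ∀ m₁ m₂ {x y z} → Tripleᴹ (combine m₁ m₂) x y z → ChildTriple m₁ m₂ x y z
Tripleᴹ-combine⁻ nothing  _        s                = subʳ s
Tripleᴹ-combine⁻ (just _) nothing  s                = subˡ s
Tripleᴹ-combine⁻ (just _) (just _) (rootˡ x∈ y∈ z∈) = rootˡ x∈ y∈ z∈
Tripleᴹ-combine⁻ (just _) (just _) (rootʳ x∈ y∈ z∈) = rootʳ x∈ y∈ z∈
Tripleᴹ-combine⁻ (just _) (just _) (subˡ s)         = subˡ s
Tripleᴹ-combine⁻ (just _) (just _) (subʳ s)         = subʳ s

Triple-restrict⁺ : ∀ {t Y x y z} → Triple t x y z → x ∈ Y → y ∈ Y → z ∈ Y → Tripleᴹ (restrict t Y) x y z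
Triple-restrict⁺ {node a b} {Y} {x} {y} {z} s x∈Y y∈Y z∈Y = Tripleᴹ-combine⁺ (restrict a Y) (restrict b Y) (child s)
  where
  child : Triple (node a b) x y z → ChildTriple (restrict a Y) (restrict b Y) x y z
  child (rootˡ x∈ y∈ z∈) = rootˡ (∈-restrict⁺ a x∈ x∈Y) (∈-restrict⁺ a y∈ y∈Y) (∈-restrict⁺ b z∈ z∈Y)
  child (rootʳ x∈ y∈ z∈) = rootʳ (∈-restrict⁺ b x∈ x∈Y) (∈-restrict⁺ b y∈ y∈Y) (∈-restrict⁺ a z∈ z∈Y)
  child (subˡ s)         = subˡ (Triple-restrict⁺ s x∈Y y∈Y z∈Y)
  child (subʳ s)         = subʳ (Triple-restrict⁺ s x∈Y y∈Y z∈Y)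

Triple-restrict⁻ : ∀ t {Y x y z} → Tripleᴹ (restrict t Y) x y z → Triple t x y z
Triple-restrict⁻ (leaf w) {Y} s with does (w ∈? Y)
Triple-restrict⁻ (leaf w) () | true
Triple-restrict⁻ (leaf w) () | false
Triple-restrict⁻ (node a b) {Y} s with Tripleᴹ-combine⁻ (restrict a Y) (restrict b Y) s
... | rootˡ x∈ y∈ z∈ = rootˡ (proj₁ (∈-restrict⁻ a x∈)) (proj₁ (∈-restrict⁻ a y∈)) (proj₁ (∈-restrict⁻ b z∈))
... | rootʳ x∈ y∈ z∈ = rootʳ (proj₁ (∈-restrict⁻ b x∈)) (proj₁ (∈-restrict⁻ b y∈)) (proj₁ (∈-restrict⁻ a z∈))
... | subˡ s′        = subˡ (Triple-restrict⁻ a s′)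
... | subʳ s′        = subʳ (Triple-restrict⁻ b s′)

graft : Tree → ℕ → Tree
graft t l = node t (leaf l)

leaves-foldl-graft : ∀ t ls → leaves (foldl graft t ls) ≡ leaves t ++ ls
leaves-foldl-graft t []       = sym (++-identityʳ (leaves t))
leaves-foldl-graft t (l ∷ ls) = trans (leaves-foldl-graft (graft t l) ls) (++-assoc (leaves t) (l ∷ []) ls)

leavesᴹ-caterpillar : ∀ l ls → leavesᴹ (caterpillarL (l ∷ ls)) ≡ l ∷ ls
leavesᴹ-caterpillar l = leaves-foldl-graft (leaf l)

Triple-foldl-graft : ∀ {t x y z} ls → Triple t x y z → Triple (foldl graft t ls) x y z
Triple-foldl-graft []       s = s
Triple-foldl-graft (l ∷ ls) s = Triple-foldl-graft ls (subˡ s)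

Triple-graft-∈ : ∀ t ls {x y z} → x ∈ leaves t → y ∈ leaves t → z ∈ ls → Triple (foldl graft t ls) x y z
Triple-graft-∈ t (l ∷ ls) x∈ y∈ (here refl) = Triple-foldl-graft ls (rootˡ x∈ y∈ (here refl))
Triple-graft-∈ t (l ∷ ls) x∈ y∈ (there z∈)  = Triple-graft-∈ (graft t l) ls (∈-++⁺ˡ x∈) (∈-++⁺ˡ y∈) z∈

Triple-graft-⊑₂ : ∀ t ls {x y z} → x ∈ leaves t → (y ∷ z ∷ []) ⊑ ls → Triple (foldl graft t ls) x y z
Triple-graft-⊑₂ t (l ∷ ls) x∈ (_ ∷ʳ yz⊑)   = Triple-graft-⊑₂ (graft t l) ls (∈-++⁺ˡ x∈) yz⊑
Triple-graft-⊑₂ t (l ∷ ls) x∈ (refl ∷ z⊑) =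
  Triple-graft-∈ (graft t l) ls (∈-++⁺ˡ x∈) (∈-++⁺ʳ (leaves t) (here refl)) (lookup z⊑ (here refl))

Triple-graft-⊑₃ : ∀ t ls {x y z} → (x ∷ y ∷ z ∷ []) ⊑ ls → Triple (foldl graft t ls) x y z
Triple-graft-⊑₃ t (l ∷ ls) (_ ∷ʳ xyz⊑)  = Triple-graft-⊑₃ (graft t l) ls xyz⊑
Triple-graft-⊑₃ t (l ∷ ls) (refl ∷ yz⊑) = Triple-graft-⊑₂ (graft t l) ls (∈-++⁺ʳ (leaves t) (here refl)) yz⊑

Triple-caterpillar : ∀ L {x y z} → (x ∷ y ∷ z ∷ []) ⊑ L → Tripleᴹ (caterpillarL L) x y z
Triple-caterpillar (l ∷ ls) (_ ∷ʳ xyz⊑)  = Triple-graft-⊑₃ (leaf l) ls xyz⊑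
Triple-caterpillar (l ∷ ls) (refl ∷ yz⊑) = Triple-graft-⊑₂ (leaf l) ls (here refl) yz⊑

MeetInAtMostTwo : List ℕ → Tree → Tree → Set
MeetInAtMostTwo Y A B =
  ∀ {Z} → Unique Z → (∀ {x} → x ∈ Z → x ∈ leaves A × x ∈ leaves B × x ∈ Y) → length Z ≤ 2

MeetInAtMostTwo-sym : ∀ {Y} {A B} → MeetInAtMostTwo Y A B → MeetInAtMostTwo Y B A
MeetInAtMostTwo-sym meet Z! Z⊆ = meet Z! λ x∈Z → let x∈B , x∈A , x∈Y = Z⊆ x∈Z in x∈A , x∈B , x∈Y

agreement-meets-caterpillar≤2 :
  ∀ {S T Sᵢ Tⱼ Y C l ls} → Unique (leaves T) → Pendant Sᵢ S → Pendant Tⱼ T →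
  restrict S Y ≅ᴹ restrict T Y →
  restrict Sᵢ C ≅ᴹ caterpillarL (l ∷ ls) → restrict Tⱼ C ≅ᴹ caterpillarL (reverse (l ∷ ls)) →
  length (filter (_∈? Y) (l ∷ ls)) ≤ 2
agreement-meets-caterpillar≤2 {S} {T} {Sᵢ} {Tⱼ} {Y} {_} {l} {ls} T! Sᵢ⊑S Tⱼ⊑T agree Sᵢ≅cat Tⱼ≅cat
  with filter (_∈? Y) (l ∷ ls) in eq
... | []             = z≤n
... | _ ∷ []         = s≤s z≤n
... | _ ∷ _ ∷ []     = s≤s (s≤s z≤n)
... | u ∷ v ∷ w ∷ us = ⊥-elim (Triple-rotate-⊥ T! uv∣w (Triple-swap wv∣u))
  where
  uvw⊑L : (u ∷ v ∷ w ∷ []) ⊑ (l ∷ ls)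
  uvw⊑L = ⊆-trans (refl ∷ refl ∷ refl ∷ minimum us) (subst (_⊑ (l ∷ ls)) eq (filter-⊆ (_∈? Y) (l ∷ ls)))
  ∈Y : ∀ {x} → x ∈ u ∷ v ∷ w ∷ us → x ∈ Y
  ∈Y x∈ = proj₂ (∈-filter⁻ (_∈? Y) (subst (_ ∈_) (sym eq) x∈))
  uv∣w-in-S : Triple S u v w
  uv∣w-in-S = Triple-Pendant Sᵢ⊑S (Triple-restrict⁻ Sᵢ
    (Tripleᴹ-≅ᴹ (≅ᴹ-sym Sᵢ≅cat) (Triple-caterpillar (l ∷ ls) uvw⊑L)))
  uv∣w : Triple T u v w
  uv∣w = Triple-restrict⁻ T (Tripleᴹ-≅ᴹ agree
    (Triple-restrict⁺ uv∣w-in-S (∈Y (here refl)) (∈Y (there (here refl))) (∈Y (there (there (here refl))))))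
  wv∣u : Triple T w v u
  wv∣u = Triple-Pendant Tⱼ⊑T (Triple-restrict⁻ Tⱼ
    (Tripleᴹ-≅ᴹ (≅ᴹ-sym Tⱼ≅cat) (Triple-caterpillar (reverse (l ∷ ls)) (reverse⁺ uvw⊑L))))

anti-caterpillar-cell : ∀ {S T Sᵢ Tⱼ Y} → Unique (leaves T) → Pendant Sᵢ S → Pendant Tⱼ T →
  restrict S Y ≅ᴹ restrict T Y →
  AntiCaterpillars (restrict Sᵢ (common Sᵢ Tⱼ)) (restrict Tⱼ (common Sᵢ Tⱼ)) →
  MeetInAtMostTwo Y Sᵢ Tⱼ
anti-caterpillar-cell {Sᵢ = Sᵢ} {Tⱼ} {Y} T! Sᵢ⊑S Tⱼ⊑T agree (l , ls , Sᵢ≅cat , Tⱼ≅cat) {Z} Z! Z⊆ =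
  ≤-trans (Unique-⊆⇒length≤ Z! Z⊆caterpillar)
          (agreement-meets-caterpillar≤2 T! Sᵢ⊑S Tⱼ⊑T agree Sᵢ≅cat Tⱼ≅cat)
  where
  Z⊆caterpillar : Z ⊆ filter (_∈? Y) (l ∷ ls)
  Z⊆caterpillar x∈Z with Z⊆ x∈Z
  ... | x∈Sᵢ , x∈Tⱼ , x∈Y = ∈-filter⁺ (_∈? Y)
    (subst (_ ∈_) (leavesᴹ-caterpillar l ls)
      (≅ᴹ-⊆ Sᵢ≅cat (∈-restrict⁺ Sᵢ x∈Sᵢ (∈-filter⁺ (_∈? leaves Tⱼ) x∈Sᵢ x∈Tⱼ))))
    x∈Y

x+x≡2*x : ∀ x → x + x ≡ 2 * x
x+x≡2*x x = cong (x +_) (sym (+-identityʳ x))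

sum≡⇒≡ : ∀ {m n o} → m ≤ o → n ≤ o → m + n ≡ o + o → m ≡ o
sum≡⇒≡ m≤o n≤o e with m≤n⇒m<n∨m≡n m≤o
... | inj₁ m<o = ⊥-elim (<-irrefl e (+-mono-<-≤ m<o n≤o))
... | inj₂ m≡o = m≡o

Perfect : Tree → Set
Perfect t = size t ≡ 2 ^ height t

Balanced⇒Perfect : ∀ {t} → Balanced t → Perfect t
Balanced⇒Perfect (_ , size≡ , refl) = size≡

size≤2^height : ∀ t → size t ≤ 2 ^ height t

size≤2^ : ∀ t {M} → height t ≤ M → size t ≤ 2 ^ M
size≤2^ t h≤M = ≤-trans (size≤2^height t) (^-monoʳ-≤ 2 h≤M)

size≤2^height (leaf _)   = ≤-refl
size≤2^height (node a b) = begin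
  size (node a b)  ≡⟨ size-node a b ⟩
  size a + size b  ≤⟨ +-mono-≤ (size≤2^ a (m≤m⊔n (height a) (height b)))
                              (size≤2^ b (m≤n⊔m (height a) (height b))) ⟩
  2 ^ M + 2 ^ M    ≡⟨ cong (2 ^ M +_) (+-identityʳ (2 ^ M)) ⟨
  2 ^ suc M        ∎
  where
  open ≤-Reasoning
  M : ℕ
  M = height a ⊔ height b

size≡2^⇒Perfect : ∀ t {M} → height t ≤ M → size t ≡ 2 ^ M → Perfect t × height t ≡ M
size≡2^⇒Perfect t {M} h≤M s≡ with m≤n⇒m<n∨m≡n h≤M
... | inj₂ refl = s≡ , refl
... | inj₁ h<M  = ⊥-elim (<-irrefl s≡ (≤-<-trans (size≤2^height t) (^-monoʳ-< 2 (s≤s (s≤s z≤n)) h<M)))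

-- Each child has at most 2 ^ M leaves and together they have 2 ^ M + 2 ^ M, so each has exactly 2 ^ M.
Perfect-children : ∀ {a b n} → Perfect (node a b) → height (node a b) ≡ suc n →
                   Perfect a × Perfect b × height a ≡ n × height b ≡ n
Perfect-children {a} {b} perfect refl =
  let perfect-a , ha = size≡2^⇒Perfect a hˡ (sum≡⇒≡ (size≤2^ a hˡ) (size≤2^ b hʳ) sum)
      perfect-b , hb = size≡2^⇒Perfect b hʳ (sum≡⇒≡ (size≤2^ b hʳ) (size≤2^ a hˡ)
                                                   (trans (+-comm (size b) (size a)) sum))
  in perfect-a , perfect-b , ha , hb
  where
  M : ℕ
  M = height a ⊔ height b
  hˡ : height a ≤ M
  hˡ = m≤m⊔n (height a) (height b)
  hʳ : height b ≤ M
  hʳ = m≤n⊔m (height a) (height b)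
  sum : size a + size b ≡ 2 ^ M + 2 ^ M
  sum = trans (sym (size-node a b)) (trans perfect (cong (2 ^ M +_) (+-identityʳ (2 ^ M))))

record Blocks (k : ℕ) (X : Tree) {n : ℕ} (F : Fin n → Tree) : Set where
  field
    labels-unique : Unique (leaves X)
    pendant       : ∀ j → Pendant (F j) X
    size-block    : ∀ j → size (F j) ≡ 2 ^ k
    partition     : leaves X ↭ familyLeaves F

module _ {k n X} {F : Fin n → Tree} (blocks : Blocks k X F) where
  open Blocks blocks

  -- A leaf of V lies in some block F j, and pendant subtrees of X sharing a leaf are nested.
  enclosing-block : ∀ {V} → Pendant V X → size V ≡ 2 ^ k → ∃ λ j → Pendant V (F j)
  enclosing-block {V} V⊑X size≡ with some-leaf V
  ... | x , x∈V with satisfied (∈-concatMap⁻ (λ j → leaves (F j)) {xs = allFin n}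
                                 (∈-resp-↭ partition (Pendant-⊆ V⊑X x∈V)))
  ... | j , x∈Fj with Pendant-nested labels-unique V⊑X (pendant j) x∈V x∈Fj
  ... | inj₁ V⊑Fj = j , V⊑Fj
  ... | inj₂ Fj⊑V = j , subst (Pendant V) (sym (Pendant-size≡⇒≡ Fj⊑V (trans (size-block j) (sym size≡)))) here

  length-filter-subtree≤ : ∀ {P : ℕ → Set} (P? : Decidable P) {c} → (∀ j → length (filter P? (leaves (F j))) ≤ c) →
                           ∀ b {V} → Pendant V X → Perfect V → height V ≡ b + k →
                           length (filter P? (leaves V)) ≤ c * 2 ^ b
  length-filter-subtree≤ P? {c} per-block zero {V} V⊑X perfect h
    with enclosing-block V⊑X (trans perfect (cong (2 ^_) h))
  ... | j , V⊑Fj = begin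
    length (filter P? (leaves V))      ≤⟨ Unique-⊆⇒length≤ (Unique.filter⁺ P? (Pendant-Unique V⊑X labels-unique))
                                                            (filter⁺′ P? P? (λ p → p) (Pendant-⊆ V⊑Fj)) ⟩
    length (filter P? (leaves (F j)))  ≤⟨ per-block j ⟩
    c                                  ≡⟨ *-identityʳ c ⟨
    c * 2 ^ 0                          ∎
    where open ≤-Reasoning
  length-filter-subtree≤ P? {c} per-block (suc b) {node V₁ V₂} V⊑X perfect h with Perfect-children perfect h
  ... | perfect₁ , perfect₂ , h₁ , h₂ = begin
    length (filter P? (leaves V₁ ++ leaves V₂))              ≡⟨ cong length (filter-++ P? (leaves V₁) (leaves V₂)) ⟩
    length (filter P? (leaves V₁) ++ filter P? (leaves V₂))  ≡⟨ length-++ (filter P? (leaves V₁)) ⟩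
    length (filter P? (leaves V₁)) + length (filter P? (leaves V₂))
      ≤⟨ +-mono-≤ (length-filter-subtree≤ P? per-block b (Pendant-childˡ V⊑X) perfect₁ h₁)
                  (length-filter-subtree≤ P? per-block b (Pendant-childʳ V⊑X) perfect₂ h₂) ⟩
    c * 2 ^ b + c * 2 ^ b                                    ≡⟨ x+x≡2*x (c * 2 ^ b) ⟩
    2 * (c * 2 ^ b)                                          ≡⟨ x∙yz≈y∙xz 2 c (2 ^ b) ⟩
    c * 2 ^ suc b                                            ∎
    where open ≤-Reasoning

  sizeᴹ-restrict-subtree≤ : ∀ {Y} W → (∀ j → MeetInAtMostTwo Y (F j) W) →
                      ∀ b {V} → Pendant V X → Perfect V → height V ≡ b + k →
                      leavesᴹ (restrict V Y) ⊆ leaves W → sizeᴹ (restrict V Y) ≤ 2 * 2 ^ b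
  sizeᴹ-restrict-subtree≤ {Y} W meet b {V} V⊑X perfect h V|Y⊆W =
    ≤-trans (Unique-⊆⇒length≤ (Unique-restrict V Y (Pendant-Unique V⊑X labels-unique)) V|Y⊆shared)
            (length-filter-subtree≤ shared? per-block b V⊑X perfect h)
    where
    shared? : Decidable (λ x → x ∈ Y × x ∈ leaves W)
    shared? x = x ∈? Y ×-dec x ∈? leaves W
    V|Y⊆shared : leavesᴹ (restrict V Y) ⊆ filter shared? (leaves V)
    V|Y⊆shared x∈ = let x∈V , x∈Y = ∈-restrict⁻ V x∈ in ∈-filter⁺ shared? x∈V (x∈Y , V|Y⊆W x∈)
    per-block : ∀ j → length (filter shared? (leaves (F j))) ≤ 2
    per-block j = meet j (Unique.filter⁺ shared? (Pendant-Unique (pendant j) labels-unique))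
      λ x∈ → let x∈Fj , x∈Y , x∈W = ∈-filter⁻ shared? x∈ in x∈Fj , x∈W , x∈Y

IsoSize≤ : ℕ → Maybe Tree → Maybe Tree → Set
IsoSize≤ n r s = r ≅ᴹ s → sizeᴹ r ≤ n

IsoSize≤-mono : ∀ {m n r s} → m ≤ n → IsoSize≤ m r s → IsoSize≤ n r s
IsoSize≤-mono m≤n bound r≅s = ≤-trans (bound r≅s) m≤n

-- Either one side is a single child (the other child being empty), or the children are matched pairwise.
combine-IsoSize≤ : ∀ {m n} r₁ r₂ s₁ s₂ → m + m ≤ n →
  IsoSize≤ n r₁ (combine s₁ s₂) → IsoSize≤ n r₂ (combine s₁ s₂) →
  IsoSize≤ n (combine r₁ r₂) s₁ → IsoSize≤ n (combine r₁ r₂) s₂ →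
  IsoSize≤ m r₁ s₁ → IsoSize≤ m r₂ s₂ → IsoSize≤ m r₁ s₂ → IsoSize≤ m r₂ s₁ →
  IsoSize≤ n (combine r₁ r₂) (combine s₁ s₂)
combine-IsoSize≤ nothing  _        _        _        _ _ only₂ _ _     _ _ _ _ = only₂
combine-IsoSize≤ (just _) nothing  _        _        _ only₁ _ _ _     _ _ _ _ = only₁
combine-IsoSize≤ (just _) (just _) nothing  _        _ _ _ _ only₂     _ _ _ _ = only₂
combine-IsoSize≤ (just _) (just _) (just _) nothing  _ _ _ only₁ _     _ _ _ _ = only₁
combine-IsoSize≤ (just a) (just b) (just _) (just _) 2m≤n _ _ _ _ a≅c b≅d _ _ (just≅ (node≅ p q)) =
  subst (_≤ _) (sym (size-node a b)) (≤-trans (+-mono-≤ (a≅c (just≅ p)) (b≅d (just≅ q))) 2m≤n)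
combine-IsoSize≤ (just a) (just b) (just _) (just _) 2m≤n _ _ _ _ _ _ a≅d b≅c (just≅ (swap≅ p q)) =
  subst (_≤ _) (sym (size-node a b)) (≤-trans (+-mono-≤ (a≅d (just≅ p)) (b≅c (just≅ q))) 2m≤n)

module _ {k p q S T} {Ss : Fin p → Tree} {Ts : Fin q → Tree}
         (blocksS : Blocks k S Ss) (blocksT : Blocks k T Ts) {Y : List ℕ}
         (cells : ∀ i j → MeetInAtMostTwo Y (Ss i) (Ts j)) where

  agreement-size≤ : ∀ a b {U V} → Pendant U S → Pendant V T → Perfect U → Perfect V →
                    height U ≡ a + k → height V ≡ b + k →
                    IsoSize≤ (2 * (2 ^ a ⊔ 2 ^ b)) (restrict U Y) (restrict V Y)
  agreement-size≤ zero b {U} {V} U⊑S V⊑T perfectU perfectV hU hV U≅V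
    with enclosing-block blocksS U⊑S (trans perfectU (cong (2 ^_) hU))
  ... | i , U⊑Sᵢ = begin
    sizeᴹ (restrict U Y)  ≡⟨ ≅ᴹ-size U≅V ⟩
    sizeᴹ (restrict V Y)  ≤⟨ sizeᴹ-restrict-subtree≤ blocksT (Ss i)
                               (λ j → MeetInAtMostTwo-sym {A = Ss i} {Ts j} (cells i j)) b V⊑T perfectV hV V|Y⊆Sᵢ ⟩
    2 * 2 ^ b             ≤⟨ *-monoʳ-≤ 2 (m≤n⊔m (2 ^ 0) (2 ^ b)) ⟩
    2 * (2 ^ 0 ⊔ 2 ^ b)   ∎
    where
    open ≤-Reasoning
    V|Y⊆Sᵢ : leavesᴹ (restrict V Y) ⊆ leaves (Ss i)
    V|Y⊆Sᵢ x∈ = Pendant-⊆ U⊑Sᵢ (proj₁ (∈-restrict⁻ U (≅ᴹ-⊆ (≅ᴹ-sym U≅V) x∈)))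
  agreement-size≤ (suc a) zero {U} {V} U⊑S V⊑T perfectU perfectV hU hV U≅V
    with enclosing-block blocksT V⊑T (trans perfectV (cong (2 ^_) hV))
  ... | j , V⊑Tⱼ = begin
    sizeᴹ (restrict U Y)       ≤⟨ sizeᴹ-restrict-subtree≤ blocksS (Ts j) (λ i → cells i j)
                                    (suc a) U⊑S perfectU hU U|Y⊆Tⱼ ⟩
    2 * 2 ^ suc a              ≤⟨ *-monoʳ-≤ 2 (m≤m⊔n (2 ^ suc a) (2 ^ 0)) ⟩
    2 * (2 ^ suc a ⊔ 2 ^ 0)    ∎
    where
    open ≤-Reasoning
    U|Y⊆Tⱼ : leavesᴹ (restrict U Y) ⊆ leaves (Ts j)
    U|Y⊆Tⱼ x∈ = Pendant-⊆ V⊑Tⱼ (proj₁ (∈-restrict⁻ V (≅ᴹ-⊆ U≅V x∈)))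
  agreement-size≤ (suc a) (suc b) {node U₁ U₂} {node V₁ V₂} U⊑S V⊑T perfectU perfectV hU hV
    with Perfect-children perfectU hU | Perfect-children perfectV hV
  ... | perfectU₁ , perfectU₂ , hU₁ , hU₂ | perfectV₁ , perfectV₂ , hV₁ , hV₂ =
    combine-IsoSize≤ (restrict U₁ Y) (restrict U₂ Y) (restrict V₁ Y) (restrict V₂ Y) (≤-reflexive doubling)
        (IsoSize≤-mono growˡ (agreement-size≤ a (suc b) (Pendant-childˡ U⊑S) V⊑T perfectU₁ perfectV hU₁ hV))
        (IsoSize≤-mono growˡ (agreement-size≤ a (suc b) (Pendant-childʳ U⊑S) V⊑T perfectU₂ perfectV hU₂ hV))
        (IsoSize≤-mono growʳ (agreement-size≤ (suc a) b U⊑S (Pendant-childˡ V⊑T) perfectU perfectV₁ hU hV₁))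
        (IsoSize≤-mono growʳ (agreement-size≤ (suc a) b U⊑S (Pendant-childʳ V⊑T) perfectU perfectV₂ hU hV₂))
        (agreement-size≤ a b (Pendant-childˡ U⊑S) (Pendant-childˡ V⊑T) perfectU₁ perfectV₁ hU₁ hV₁)
        (agreement-size≤ a b (Pendant-childʳ U⊑S) (Pendant-childʳ V⊑T) perfectU₂ perfectV₂ hU₂ hV₂)
        (agreement-size≤ a b (Pendant-childˡ U⊑S) (Pendant-childʳ V⊑T) perfectU₁ perfectV₂ hU₁ hV₂)
        (agreement-size≤ a b (Pendant-childʳ U⊑S) (Pendant-childˡ V⊑T) perfectU₂ perfectV₁ hU₂ hV₁)
    where
    2^≤2^suc : ∀ n → 2 ^ n ≤ 2 ^ suc n
    2^≤2^suc n = ^-monoʳ-≤ 2 (n≤1+n n)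
    growˡ : 2 * (2 ^ a ⊔ 2 ^ suc b) ≤ 2 * (2 ^ suc a ⊔ 2 ^ suc b)
    growˡ = *-monoʳ-≤ 2 (⊔-monoˡ-≤ (2 ^ suc b) (2^≤2^suc a))
    growʳ : 2 * (2 ^ suc a ⊔ 2 ^ b) ≤ 2 * (2 ^ suc a ⊔ 2 ^ suc b)
    growʳ = *-monoʳ-≤ 2 (⊔-monoʳ-≤ (2 ^ suc a) (2^≤2^suc b))
    doubling : 2 * (2 ^ a ⊔ 2 ^ b) + 2 * (2 ^ a ⊔ 2 ^ b) ≡ 2 * (2 ^ suc a ⊔ 2 ^ suc b)
    doubling = trans (x+x≡2*x (2 * (2 ^ a ⊔ 2 ^ b))) (cong (2 *_) (*-distribˡ-⊔ 2 (2 ^ a) (2 ^ b)))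

power-of-two-factor : ∀ k m p → p * 2 ^ k ≡ 2 ^ m → ∃ λ a → m ≡ a + k × p ≡ 2 ^ a
power-of-two-factor zero    m       p e = m , sym (+-identityʳ m) , trans (sym (*-identityʳ p)) e
power-of-two-factor (suc k) zero    p e with m*n≡1⇒m≡1 2 (2 ^ k) (m*n≡1⇒n≡1 p (2 ^ suc k) e)
... | ()
power-of-two-factor (suc k) (suc m) p e
  with power-of-two-factor k m p (*-cancelˡ-≡ (p * 2 ^ k) (2 ^ m) 2
         (trans (x∙yz≈y∙xz 2 p (2 ^ k)) e))
... | a , refl , p≡2^a = a , sym (+-suc a k) , p≡2^a

lemma8 : (k p q r : ℕ) → 1 ≤ k → 1 ≤ p → 1 ≤ q → 1 ≤ r →
         (S T : Tree) → Phylo S → Phylo T → Balanced S → Balanced T →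
         size S ≡ p * 2 ^ k → size T ≡ q * 2 ^ k →
         (Ss : Fin p → Tree) → (Ts : Fin q → Tree) →
         (∀ i → Pendant (Ss i) S) → (∀ j → Pendant (Ts j) T) →
         (∀ i → size (Ss i) ≡ 2 ^ k) → (∀ j → size (Ts j) ≡ 2 ^ k) →
         leaves S ↭ familyLeaves Ss → leaves T ↭ familyLeaves Ts →
         (∀ i j → length (common (Ss i) (Ts j)) ≡ r) →
         (∀ i j → AntiCaterpillars (restrict (Ss i) (common (Ss i) (Ts j)))
                                   (restrict (Ts j) (common (Ss i) (Ts j)))) →
         MastAtMost S T (2 * (p ⊔ q))
lemma8 k p q _ _ _ _ _ S T S! T! balancedS@(m , sizeS≡ , hS) balancedT@(n , sizeT≡ , hT) sizeS sizeT
       Ss Ts Sᵢ⊑S Tⱼ⊑T sizeSᵢ sizeTⱼ partitionS partitionT _ anti Y (Y! , Y⊆S×T , agree)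
  with power-of-two-factor k m p (trans (sym sizeS) sizeS≡) | power-of-two-factor k n q (trans (sym sizeT) sizeT≡)
... | a , refl , refl | b , refl , refl = begin
  length Y              ≤⟨ Unique-⊆⇒length≤ Y! (λ y∈Y → ∈-restrict⁺ S (proj₁ (Y⊆S×T y∈Y)) y∈Y) ⟩
  sizeᴹ (restrict S Y)  ≤⟨ agreement-size≤ blocksS blocksT cells a b here here
                             (Balanced⇒Perfect balancedS) (Balanced⇒Perfect balancedT) hS hT agree ⟩
  2 * (2 ^ a ⊔ 2 ^ b)   ∎
  where
  open ≤-Reasoning
  blocksS : Blocks k S Ss
  blocksS = record { labels-unique = S! ; pendant = Sᵢ⊑S ; size-block = sizeSᵢ ; partition = partitionS }
  blocksT : Blocks k T Ts
  blocksT = record { labels-unique = T! ; pendant = Tⱼ⊑T ; size-block = sizeTⱼ ; partition = partitionT }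
  cells : ∀ i j → MeetInAtMostTwo Y (Ss i) (Ts j)
  cells i j = anti-caterpillar-cell T! (Sᵢ⊑S i) (Tⱼ⊑T j) agree (anti i j)
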